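{- Define $\iota:\mathbb N\to\mathbb N$ by $$\iota(n)=\begin{cases}\lfloor(\varphi+1)n-2\rfloor,& n\in R_{1,0},\\ \lfloor\varphi n+2\rfloor,& n\in R_{3,1},\\ \lfloor(\varphi-1)n+2\rfloor,& n\in R_{2,2},\\ \lfloor(\varphi-1)n\rfloor,& n\in R_{2,0}.\end{cases}$$ Then $\iota$ is a permutation of $\mathbb N$ of order $6$. Moreover its powers (iterated compositions) are given by: $$\iota^2(n)=\begin{cases}\lfloor\varphi n+2\rfloor,& n\in R_{2,2},\\ \lfloor\varphi n-2\rfloor,& n\in R_{1,0},\\ n,& n\in R_{4,0}\cup R_{3,1},\\ \lfloor(2-\varphi)n+1\rfloor,& n\in R_{3,2};\end{cases}\qquad \iota^3(n)=\begin{cases}\lfloor\varphi n+2\rfloor,& n\in R_{3,1},\\ \lfloor(\varphi-1)n\rfloor,& n\in R_{4,0},\\ n,& n\in R_{3,2}\cup R_{2,2}\cup R_{1,0};\end{cases}$$ $$\iota^4(n)=\begin{cases}\lfloor(\varphi+1)n-2\rfloor,& n\in R_{1,0},\\ \lfloor(\varphi-1)n+2\rfloor,& n\in R_{2,2},\\ \lfloor(\varphi-1)n\rfloor,& n\in R_{3,2},\\ n,& n\in R_{4,0}\cup R_{3,1};\end{cases}\qquad \iota^5(n)=\iota^{ -1}(n)=\begin{cases}\lfloor\varphi n+2\rfloor,& n\in R_{1,1},\\ \lfloor\varphi n-2\rfloor,& n\in R_{1,0},\\ \lfloor(\varphi-1)n\rfloor,& n\in R_{4,0},\\ \lfloor(2-\varphi)n+1\rfloor,&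 n\in R_{3,2}.\end{cases}$$
   Context: Let $\varphi=\frac{1+\sqrt5}{2}$ and $\mathbb N=\{1,2,3,\dots\}$; $a(n)=\lfloor n\varphi\rfloor$. $F$ is the Fibonacci sequence, $F(0)=0$, $F(1)=F(2)=1$, $F(n)=F(n-1)+F(n-2)$. For $i\in\mathbb Z^{\geq0}$, $j\in\mathbb Z$, let $f_{i,j}(n)=F(i+1)a(n)+F(i)n-j$ ($n\in\mathbb N$) and $R_{i,j}=\{f_{i,j}(n)\mid n\in\mathbb N\}$. Each of the families of sets on which the maps above are defined piecewise forms a partition of $\mathbb N$ (e.g. $R_{1,0},R_{2,0},R_{2,2},R_{3,1}$; and $R_{2,0}=R_{3,2}\cup R_{4,0}$, $R_{1,1}=R_{2,2}\cup R_{3,1}$, disjointly). -}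

module Defs where

open import Data.Nat as ℕ using (ℕ; zero; suc)
open import Data.Integer using (ℤ; +_; _+_; _-_; _*_; -_; _≤_; _<_)
open import Data.Product using (Σ; _×_; ∃)
open import Data.Sum using (_⊎_)
open import Relation.Nullary using (¬_)
open import Relation.Binary.PropositionalEquality using (_≡_; _≢_)

F : ℕ → ℕ
F zero = 0
F (suc zero) = 1
F (suc (suc n)) = F (suc n) ℕ.+ F n

-- Real numbers of the form p + q·φ (p q : ℤ), φ = (1+√5)/2.
record Zφ : Set where
  constructor _+_φ
  field
    re : ℤ
    ph : ℤ

-- d ≤ q·√5  (exact comparison in ℤ[√5]):
--   if q ≥ 0 : d ≤ 0, or d² ≤ 5q²;
--   if q < 0 : d ≤ 0 and 5q² ≤ d².
LeSqrt5 : ℤ → ℤ → Set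
LeSqrt5 d q =
  ((+ 0 ≤ q) × ((d ≤ + 0) ⊎ (d * d ≤ + 5 * (q * q))))
  ⊎ ((q < + 0) × ((d ≤ + 0) × (+ 5 * (q * q) ≤ d * d)))

-- k ≤ p + qφ  ⟺  2(k - p) - q ≤ q·√5
_≤φ_ : ℤ → Zφ → Set
k ≤φ (p + q φ) = LeSqrt5 (+ 2 * (k - p) - q) q

IsFloor : ℤ → Zφ → Set
IsFloor m x = (m ≤φ x) × ¬ ((m + + 1) ≤φ x)

InR : ℕ → ℤ → ℕ → Set
InR i j m = Σ ℕ λ n → Σ ℕ λ k →
  (1 ℕ.≤ n) × IsFloor (+ k) ((+ 0) + (+ n) φ) ×
  (+ m ≡ + F (suc i) * + k + + F i * + n - j)

_^[_] : (ℕ → ℕ) → ℕ → ℕ → ℕ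
(f ^[ zero ]) n = n
(f ^[ suc k ]) n = f ((f ^[ k ]) n)

IotaSpec : (ℕ → ℕ) → Set
IotaSpec ι = ∀ n → 1 ℕ.≤ n →
  (InR 1 (+ 0) n → IsFloor (+ ι n) ((+ n - + 2) + (+ n) φ)) ×
  (InR 3 (+ 1) n → IsFloor (+ ι n) ((+ 2) + (+ n) φ)) ×
  (InR 2 (+ 2) n → IsFloor (+ ι n) ((+ 2 - + n) + (+ n) φ)) ×
  (InR 2 (+ 0) n → IsFloor (+ ι n) ((- (+ n)) + (+ n) φ))

IsPermPos : (ℕ → ℕ) → Set
IsPermPos ι =
  (∀ n → 1 ℕ.≤ n → 1 ℕ.≤ ι n) ×
  (∀ m n → 1 ℕ.≤ m → 1 ℕ.≤ n → ι m ≡ ι n → m ≡ n) ×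
  (∀ m → 1 ℕ.≤ m → Σ ℕ λ n → (1 ℕ.≤ n) × (ι n ≡ m))

HasOrder6 : (ℕ → ℕ) → Set
HasOrder6 ι =
  (∀ n → 1 ℕ.≤ n → (ι ^[ 6 ]) n ≡ n) ×
  (∀ k → 1 ℕ.≤ k → k ℕ.< 6 → Σ ℕ λ n → (1 ℕ.≤ n) × ((ι ^[ k ]) n ≢ n))

PowerFormulas : (ℕ → ℕ) → Set
PowerFormulas ι = ∀ n → 1 ℕ.≤ n →
  ((InR 2 (+ 2) n → IsFloor (+ (ι ^[ 2 ]) n) ((+ 2) + (+ n) φ)) ×
   (InR 1 (+ 0) n → IsFloor (+ (ι ^[ 2 ]) n) ((- (+ 2)) + (+ n) φ)) ×
   (InR 4 (+ 0) n ⊎ InR 3 (+ 1) n → (ι ^[ 2 ]) n ≡ n) ×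
   (InR 3 (+ 2) n → IsFloor (+ (ι ^[ 2 ]) n) ((+ 2 * + n + + 1) + (- (+ n)) φ))) ×
  ((InR 3 (+ 1) n → IsFloor (+ (ι ^[ 3 ]) n) ((+ 2) + (+ n) φ)) ×
   (InR 4 (+ 0) n → IsFloor (+ (ι ^[ 3 ]) n) ((- (+ n)) + (+ n) φ)) ×
   (InR 3 (+ 2) n ⊎ InR 2 (+ 2) n ⊎ InR 1 (+ 0) n → (ι ^[ 3 ]) n ≡ n)) ×
  ((InR 1 (+ 0) n → IsFloor (+ (ι ^[ 4 ]) n) ((+ n - + 2) + (+ n) φ)) ×
   (InR 2 (+ 2) n → IsFloor (+ (ι ^[ 4 ]) n) ((+ 2 - + n) + (+ n) φ)) ×
   (InR 3 (+ 2) n → IsFloor (+ (ι ^[ 4 ]) n) ((- (+ n)) + (+ n) φ)) ×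
   (InR 4 (+ 0) n ⊎ InR 3 (+ 1) n → (ι ^[ 4 ]) n ≡ n)) ×
  ((ι ((ι ^[ 5 ]) n) ≡ n) ×
   (InR 1 (+ 1) n → IsFloor (+ (ι ^[ 5 ]) n) ((+ 2) + (+ n) φ)) ×
   (InR 1 (+ 0) n → IsFloor (+ (ι ^[ 5 ]) n) ((- (+ 2)) + (+ n) φ)) ×
   (InR 4 (+ 0) n → IsFloor (+ (ι ^[ 5 ]) n) ((- (+ n)) + (+ n) φ)) ×
   (InR 3 (+ 2) n → IsFloor (+ (ι ^[ 5 ]) n) ((+ 2 * + n + + 1) + (- (+ n)) φ)))

-- Write a(t) = ⌊tφ⌋. The inequalities a(t) < tφ < a(t) + 1 are polynomial in a(t) and t
-- (φ² = φ + 1, and √5 is irrational), so everything is integer arithmetic. The Beatty identities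
-- a(a(t)) = a(t) + t − 1, a(a(t) + t) = 2a(t) + t and a(a(t) + 1) = a(t) + t + 1 show that the
-- lower and upper Wythoff sequences a(s) and a(t) + t partition the positive integers.
-- Descending from n through this partition (from a(s) to s, from a(t) + t to t) at most three
-- times puts n in exactly one of R₁₀, R₂₂, R₃₁, R₃₂, R₄₀, as f_{i,j}(t) for a unique t. On each
-- class the floor defining ι can be evaluated exactly: ι keeps t and moves
-- R₁₀ → R₃₂ → R₂₂ → R₁₀ and R₃₁ → R₄₀ → R₃₁. Hence ι⁶ = id, and each formula for ιᵏ is again
-- an exact floor evaluation.

module Submission where

open import Data.Nat as ℕ using (ℕ; zero; suc; z≤n; s≤s)
import Data.Nat.Properties as ℕP
open import Data.Nat.Induction using (<-rec)
import Data.Nat.Tactic.RingSolver as ℕRing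
open import Data.Nat.Divisibility using (_∣_; divides)
open import Data.Nat.Primality using (Prime; prime?; euclidsLemma)
open import Data.Integer using (ℤ; +_; -[1+_]; _+_; _-_; _*_; -_; _≤_; _<_; +≤+; -<+; ∣_∣)
import Data.Integer.Properties as ℤP
open import Data.Integer.Tactic.RingSolver using (solve-∀)
open import Data.List using (List; []; _∷_)
open import Data.Product using (Σ; _×_; _,_; proj₁; proj₂)
open import Data.Sum using (_⊎_; inj₁; inj₂; [_,_]′)
open import Data.Empty using (⊥; ⊥-elim)
open import Function using (_∘_)
open import Relation.Nullary using (¬_)
open import Relation.Nullary.Decidable using (toWitness)
open import Relation.Binary.PropositionalEquality

open import Defs

private variable
  a a′ b k p q r s s′ t t′ x y z : ℤ
  i m : ℕ
  j : ℤ

-- Inequalities are proved by certificates: the quantity is rewritten (by the ring solver)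
-- as a sum of products of quantities already known to be non-negative.

NonNeg : ℤ → Set
NonNeg x = + 0 ≤ x

nonneg : ∀ n → NonNeg (+ n)
nonneg n = +≤+ z≤n

infixr 4 _⊕_
infixr 6 _·_
infixr 7 _⊛_

_⊕_ : NonNeg x → NonNeg y → NonNeg (x + y)
+≤+ _ ⊕ +≤+ _ = +≤+ z≤n

_⊛_ : NonNeg x → NonNeg y → NonNeg (x * y)
_⊛_ {+ m} {+ n} _ _ rewrite sym (ℤP.pos-* m n) = +≤+ z≤n

_·_ : ∀ c → NonNeg x → NonNeg (+ c * x)
c · p = nonneg c ⊛ p

via : y ≡ x → NonNeg x → NonNeg y
via refl p = p

refute : ∀ k → NonNeg x → x ≡ -[1+ k ] → ⊥
refute k (+≤+ _) ()

nonneg-or-neg : ∀ x → NonNeg x ⊎ NonNeg (- x - + 1)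
nonneg-or-neg (+ n)    = inj₁ (+≤+ z≤n)
nonneg-or-neg -[1+ n ] = inj₂ (+≤+ z≤n)

≤-or-> : ∀ x y → x ≤ y ⊎ NonNeg (x - y - + 1)
≤-or-> x y with nonneg-or-neg (y - x)
... | inj₁ p = inj₁ (ℤP.0≤i-j⇒j≤i p)
... | inj₂ p = inj₂ (via (e x y) p)
  where
  e : ∀ x y → x - y - + 1 ≡ - (y - x) - + 1
  e = solve-∀

>⇒≰ : NonNeg (y - x - + 1) → ¬ y ≤ x
>⇒≰ {y} {x} p q = refute 0 (ℤP.i≤j⇒0≤j-i q ⊕ p) (e x y)
  where
  e : ∀ x y → (x - y) + (y - x - + 1) ≡ -[1+ 0 ]
  e = solve-∀

≥1⇒≮0 : NonNeg (t - + 1) → ¬ t < + 0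
≥1⇒≮0 { -[1+ n ]} () -<+

≥1⇒-<0 : NonNeg (t - + 1) → - t < + 0
≥1⇒-<0 {+ suc n} _ = -<+

≥1⇒≥0 : NonNeg (t - + 1) → NonNeg t
≥1⇒≥0 {t} p = via (e t) (p ⊕ nonneg 1)
  where
  e : ∀ t → t ≡ (t - + 1) + + 1
  e = solve-∀

nonneg-antisym : NonNeg (x - y) → NonNeg (y - x) → x ≡ y
nonneg-antisym p q = ℤP.≤-antisym (ℤP.0≤i-j⇒j≤i q) (ℤP.0≤i-j⇒j≤i p)

nonneg-÷4 : NonNeg (+ 4 * x + + 3) → NonNeg x
nonneg-÷4 {x} p with nonneg-or-neg x
... | inj₁ q = q
... | inj₂ q = ⊥-elim (refute 0 (p ⊕ 4 · q) (e x))
  where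
  e : ∀ x → (+ 4 * x + + 3) + + 4 * (- x - + 1) ≡ -[1+ 0 ]
  e = solve-∀

prime5 : Prime 5
prime5 = toWitness {a? = prime? 5} _

5∣square : ∀ d y → d ℕ.* d ≡ 5 ℕ.* y → Σ ℕ λ e → (d ≡ e ℕ.* 5) × (y ≡ 5 ℕ.* (e ℕ.* e))
5∣square d y eq = e , d≡e*5 , cancel
  where
  5∣d : 5 ∣ d
  5∣d with euclidsLemma d d prime5 (divides y (trans eq (ℕP.*-comm 5 y)))
  ... | inj₁ p = p
  ... | inj₂ p = p
  e : ℕ
  e = _∣_.quotient 5∣d
  d≡e*5 : d ≡ e ℕ.* 5
  d≡e*5 = _∣_.equality 5∣d
  square : ∀ e → (e ℕ.* 5) ℕ.* (e ℕ.* 5) ≡ 5 ℕ.* (5 ℕ.* (e ℕ.* e))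
  square = ℕRing.solve-∀
  cancel : y ≡ 5 ℕ.* (e ℕ.* e)
  cancel = sym (ℕP.*-cancelˡ-≡ (5 ℕ.* (e ℕ.* e)) y 5
             (trans (sym (square e)) (trans (cong (λ z → z ℕ.* z) (sym d≡e*5)) eq)))

-- Infinite descent: d² = 5q² forces 5 ∣ d and then 5 ∣ q.
√5-irrationalℕ : ∀ q d → d ℕ.* d ≡ 5 ℕ.* (q ℕ.* q) → q ≡ 0
√5-irrationalℕ = <-rec Claim descent
  where
  Claim : ℕ → Set
  Claim q = ∀ d → d ℕ.* d ≡ 5 ℕ.* (q ℕ.* q) → q ≡ 0
  descent : ∀ q → (∀ {r} → r ℕ.< q → Claim r) → Claim q
  descent q rec d eq = from-5∣d (5∣square d (q ℕ.* q) eq)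
    where
    from-5∣d : (Σ ℕ λ e → (d ≡ e ℕ.* 5) × (q ℕ.* q ≡ 5 ℕ.* (e ℕ.* e))) → q ≡ 0
    from-5∣d (e , _ , q²≡5e²) = from-5∣q (5∣square q (e ℕ.* e) q²≡5e²)
      where
      from-5∣q : (Σ ℕ λ r → (q ≡ r ℕ.* 5) × (e ℕ.* e ≡ 5 ℕ.* (r ℕ.* r))) → q ≡ 0
      from-5∣q (zero , q≡0 , _) = q≡0
      from-5∣q (suc r , q≡r*5 , e²≡5r²) = ⊥-elim (ℕP.0≢1+n (sym (rec r<q e e²≡5r²)))
        where
        r<q : suc r ℕ.< q
        r<q = subst (suc r ℕ.<_) (sym q≡r*5) (ℕP.m<m*n (suc r) 5 (s≤s (s≤s z≤n)))

√5-irrational : ∀ d q → d * d ≡ + 5 * (q * q) → q ≡ + 0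
√5-irrational d q eq = ℤP.∣i∣≡0⇒i≡0 (√5-irrationalℕ ∣ q ∣ ∣ d ∣ ∣eq∣)
  where
  ∣eq∣ : ∣ d ∣ ℕ.* ∣ d ∣ ≡ 5 ℕ.* (∣ q ∣ ℕ.* ∣ q ∣)
  ∣eq∣ = trans (sym (ℤP.abs-* d d)) (trans (cong ∣_∣ eq)
          (trans (ℤP.abs-* (+ 5) (q * q)) (cong (5 ℕ.*_) (ℤP.abs-* q q))))

-- d² ≠ 5q² for q ≥ 1, so both non-strict comparisons are strict.
5q²-d²>0 : ∀ d q → NonNeg (q - + 1) → NonNeg (+ 5 * (q * q) - d * d) → NonNeg (+ 5 * (q * q) - d * d - + 1)
5q²-d²>0 d q q≥1 h with nonneg-or-neg (+ 5 * (q * q) - d * d - + 1)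
... | inj₁ p = p
... | inj₂ p = ⊥-elim (refute 0 (subst (λ z → NonNeg (z - + 1)) (√5-irrational d q (nonneg-antisym (via (e d q) p) h)) q≥1) refl)
  where
  e : ∀ d q → d * d - + 5 * (q * q) ≡ - (+ 5 * (q * q) - d * d - + 1) - + 1
  e = solve-∀

d²-5q²>0 : ∀ d q → NonNeg (q - + 1) → NonNeg (d * d - + 5 * (q * q)) → NonNeg (d * d - + 5 * (q * q) - + 1)
d²-5q²>0 d q q≥1 h with nonneg-or-neg (d * d - + 5 * (q * q) - + 1)
... | inj₁ p = p
... | inj₂ p = ⊥-elim (refute 0 (subst (λ z → NonNeg (z - + 1)) (√5-irrational d q (nonneg-antisym h (via (e d q) p))) q≥1) refl)
  where
  e : ∀ d q → + 5 * (q * q) - d * d ≡ - (d * d - + 5 * (q * q) - + 1) - + 1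
  e = solve-∀

-- The floor of tφ

-- a = ⌊tφ⌋ with t ≥ 1: the inequalities a < tφ < a + 1, multiplied out as
-- a² − at − t² < 0 < (a + 1)² − (a + 1)t − t².
record IsFloorφ (a t : ℤ) : Set where
  constructor isFloorφ
  field
    below : NonNeg (a * t + t * t - a * a - + 1)
    above : NonNeg (a * a - a * t - t * t + + 2 * a - t)
    t≥1   : NonNeg (t - + 1)
open IsFloorφ

t<2a : IsFloorφ a t → NonNeg (+ 2 * a - t - + 1)
t<2a {a} {t} f = via (e a t) (below f ⊕ above f)
  where
  e : ∀ a t → + 2 * a - t - + 1 ≡ (a * t + t * t - a * a - + 1) + (a * a - a * t - t * t + + 2 * a - t)
  e = solve-∀

t≤a : IsFloorφ a t → NonNeg (a - t)
t≤a {a} {t} f with nonneg-or-neg (a - t)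
... | inj₁ p = p
... | inj₂ p = ⊥-elim (refute 1 (2 · above f ⊕ 2a≥0 ⊛ p ⊕ 2 · p ⊕ 2 · (t≥0 ⊛ t≥0)) (e a t))
  where
  t≥0 : NonNeg t
  t≥0 = ≥1⇒≥0 (t≥1 f)
  2a≥0 : NonNeg (+ 2 * a)
  2a≥0 = via (e′ a t) (t<2a f ⊕ t≥1 f ⊕ nonneg 2)
    where
    e′ : ∀ a t → + 2 * a ≡ (+ 2 * a - t - + 1) + ((t - + 1) + + 2)
    e′ = solve-∀
  e : ∀ a t → + 2 * (a * a - a * t - t * t + + 2 * a - t) + ((+ 2 * a) * (- (a - t) - + 1) + (+ 2 * (- (a - t) - + 1) + + 2 * (t * t))) ≡ -[1+ 1 ]
  e = solve-∀

a<2t : IsFloorφ a t → NonNeg (+ 2 * t - + 1 - a)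
a<2t {a} {t} f with nonneg-or-neg (+ 2 * t - + 1 - a)
... | inj₁ p = p
... | inj₂ p = ⊥-elim (refute 0 (below f ⊕ t≥0 ⊛ t≥0 ⊕ 3 · (t≥0 ⊛ p) ⊕ p ⊛ p) (e a t))
  where
  t≥0 : NonNeg t
  t≥0 = ≥1⇒≥0 (t≥1 f)
  e : ∀ a t → (a * t + t * t - a * a - + 1) + (t * t + (+ 3 * (t * (- (+ 2 * t - + 1 - a) - + 1)) + (- (+ 2 * t - + 1 - a) - + 1) * (- (+ 2 * t - + 1 - a) - + 1))) ≡ -[1+ 0 ]
  e = solve-∀

a≥1 : IsFloorφ a t → NonNeg (a - + 1)
a≥1 {a} {t} f = via (e a t) (t≤a f ⊕ t≥1 f)
  where
  e : ∀ a t → a - + 1 ≡ (a - t) + (t - + 1)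
  e = solve-∀

floorφ-≮ : IsFloorφ a t → IsFloorφ a′ t → ¬ NonNeg (a′ - a - + 1)
floorφ-≮ {a} {t} {a′} f f′ a<a′ =
  refute 0 (below f′ ⊕ above f ⊕ a<a′ ⊛ via (e₁ a t) (t<2a f ⊕ nonneg 1) ⊕ via (e₂ a a′) (a<a′ ⊕ nonneg 1) ⊛ via (e₂ a a′) (a<a′ ⊕ nonneg 1)) (e a a′ t)
  where
  e₁ : ∀ a t → + 2 * a - t ≡ (+ 2 * a - t - + 1) + + 1
  e₁ = solve-∀
  e₂ : ∀ a a′ → a′ - a ≡ (a′ - a - + 1) + + 1
  e₂ = solve-∀
  e : ∀ a a′ t → (a′ * t + t * t - a′ * a′ - + 1) + ((a * a - a * t - t * t + + 2 * a - t) + ((a′ - a - + 1) * (+ 2 * a - t) + (a′ - a) * (a′ - a))) ≡ -[1+ 0 ]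
  e = solve-∀

floorφ-unique : IsFloorφ a t → IsFloorφ a′ t → a ≡ a′
floorφ-unique {a} {t} {a′} f f′ with nonneg-or-neg (a′ - a - + 1) | nonneg-or-neg (a - a′ - + 1)
... | inj₁ a<a′ | _         = ⊥-elim (floorφ-≮ f f′ a<a′)
... | inj₂ _    | inj₁ a′<a = ⊥-elim (floorφ-≮ f′ f a′<a)
... | inj₂ p    | inj₂ p′   = nonneg-antisym (via (e a a′) p) (via (e a′ a) p′)
  where
  e : ∀ a a′ → a - a′ ≡ - (a′ - a - + 1) - + 1
  e = solve-∀

floorφ-at-lower : IsFloorφ a t → IsFloorφ (a + t - + 1) a
floorφ-at-lower {a} {t} f = isFloorφ (via (e₁ a t) (above f ⊕ t≤a f ⊕ 2 · a<2t f)) (via (e₂ a t) (below f)) (via (e₃ a t) (2 · t≤a f ⊕ a<2t f))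
  where
  e₁ : ∀ a t → (a + t - + 1) * a + a * a - (a + t - + 1) * (a + t - + 1) - + 1 ≡ (a * a - a * t - t * t + + 2 * a - t) + ((a - t) + + 2 * (+ 2 * t - + 1 - a))
  e₁ = solve-∀
  e₂ : ∀ a t → (a + t - + 1) * (a + t - + 1) - (a + t - + 1) * a - a * a + + 2 * (a + t - + 1) - a ≡ a * t + t * t - a * a - + 1
  e₂ = solve-∀
  e₃ : ∀ a t → a - + 1 ≡ + 2 * (a - t) + (+ 2 * t - + 1 - a)
  e₃ = solve-∀

floorφ-at-upper : IsFloorφ a t → IsFloorφ (+ 2 * a + t) (a + t)
floorφ-at-upper {a} {t} f = isFloorφ (via (e₁ a t) (below f)) (via (e₂ a t) (above f ⊕ 4 · t≤a f ⊕ 3 · a<2t f ⊕ nonneg 3)) (via (e₃ a t) (3 · t≤a f ⊕ 2 · a<2t f ⊕ nonneg 1))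
  where
  e₁ : ∀ a t → (+ 2 * a + t) * (a + t) + (a + t) * (a + t) - (+ 2 * a + t) * (+ 2 * a + t) - + 1 ≡ a * t + t * t - a * a - + 1
  e₁ = solve-∀
  e₂ : ∀ a t → (+ 2 * a + t) * (+ 2 * a + t) - (+ 2 * a + t) * (a + t) - (a + t) * (a + t) + + 2 * (+ 2 * a + t) - (a + t) ≡ (a * a - a * t - t * t + + 2 * a - t) + (+ 4 * (a - t) + (+ 3 * (+ 2 * t - + 1 - a) + + 3))
  e₂ = solve-∀
  e₃ : ∀ a t → (a + t) - + 1 ≡ + 3 * (a - t) + (+ 2 * (+ 2 * t - + 1 - a) + + 1)
  e₃ = solve-∀

floorφ-at-lower+1 : IsFloorφ a t → IsFloorφ (a + t + + 1) (a + + 1)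
floorφ-at-lower+1 {a} {t} f = isFloorφ (via (e₁ a t) (above f)) (via (e₂ a t) (below f ⊕ t≤a f ⊕ 2 · a<2t f ⊕ nonneg 3)) (via (e₃ a t) (2 · t≤a f ⊕ a<2t f ⊕ nonneg 1))
  where
  e₁ : ∀ a t → (a + t + + 1) * (a + + 1) + (a + + 1) * (a + + 1) - (a + t + + 1) * (a + t + + 1) - + 1 ≡ a * a - a * t - t * t + + 2 * a - t
  e₁ = solve-∀
  e₂ : ∀ a t → (a + t + + 1) * (a + t + + 1) - (a + t + + 1) * (a + + 1) - (a + + 1) * (a + + 1) + + 2 * (a + t + + 1) - (a + + 1) ≡ (a * t + t * t - a * a - + 1) + ((a - t) + (+ 2 * (+ 2 * t - + 1 - a) + + 3))
  e₂ = solve-∀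
  e₃ : ∀ a t → (a + + 1) - + 1 ≡ + 2 * (a - t) + ((+ 2 * t - + 1 - a) + + 1)
  e₃ = solve-∀

-- Linear search for the least a ≤ 2t with (a + 1)² − (a + 1)t − t² > 0, keeping a < tφ.
floorφ-search : NonNeg (t - + 1) → ∀ fuel a → NonNeg (a * t + t * t - a * a - + 1) → a + + fuel ≡ + 2 * t → Σ ℤ λ a → IsFloorφ a t
floorφ-search {t} t≥1 zero a below a≡2t = a , isFloorφ below (subst (λ a → NonNeg (a * a - a * t - t * t + + 2 * a - t)) (sym (trans (sym (ℤP.+-identityʳ a)) a≡2t)) (via (e t) (t≥0 ⊛ t≥0 ⊕ 3 · t≥0))) t≥1
  where
  t≥0 : NonNeg t
  t≥0 = ≥1⇒≥0 t≥1
  e : ∀ t → (+ 2 * t) * (+ 2 * t) - (+ 2 * t) * t - t * t + + 2 * (+ 2 * t) - t ≡ t * t + + 3 * t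
  e = solve-∀
floorφ-search {t} t≥1 (suc fuel) a below a+fuel≡2t with nonneg-or-neg (a * a - a * t - t * t + + 2 * a - t)
... | inj₁ above = a , isFloorφ below above t≥1
... | inj₂ ¬above = floorφ-search t≥1 fuel (a + + 1) below′ (trans (ℤP.+-assoc a (+ 1) (+ fuel)) a+fuel≡2t)
  where
  e₁ : ∀ a t → + 5 * (t * t) - (+ 2 * (a + + 1) - t) * (+ 2 * (a + + 1) - t) ≡ + 4 * (- (a * a - a * t - t * t + + 2 * a - t) - + 1)
  e₁ = solve-∀
  e₂ : ∀ a t → + 4 * ((a + + 1) * t + t * t - (a + + 1) * (a + + 1) - + 1) + + 3 ≡ + 5 * (t * t) - (+ 2 * (a + + 1) - t) * (+ 2 * (a + + 1) - t) - + 1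
  e₂ = solve-∀
  below′ : NonNeg ((a + + 1) * t + t * t - (a + + 1) * (a + + 1) - + 1)
  below′ = nonneg-÷4 (via (e₂ a t) (5q²-d²>0 (+ 2 * (a + + 1) - t) t t≥1 (via (e₁ a t) (4 · ¬above))))

floorφ-exists : NonNeg (t - + 1) → Σ ℤ λ a → IsFloorφ a t
floorφ-exists {t} t≥1 = floorφ-search t≥1 ∣ + 2 * t ∣ (+ 0) (via (e t) (t≥1 ⊛ (t≥1 ⊕ nonneg 2))) (trans (ℤP.+-identityˡ _) (ℤP.0≤i⇒+∣i∣≡i (2 · ≥1⇒≥0 t≥1)))
  where
  e : ∀ t → + 0 * t + t * t - + 0 * + 0 - + 1 ≡ (t - + 1) * ((t - + 1) + + 2)
  e = solve-∀

IsFloorφ⇒IsFloor : IsFloorφ a t → IsFloor a ((+ 0) + t φ)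
IsFloorφ⇒IsFloor {a} {t} f = inj₁ (≥1⇒≥0 (t≥1 f) , inj₂ (ℤP.0≤i-j⇒j≤i (via (e₁ a t) (4 · (below f ⊕ nonneg 1))))) , a+1≰tφ
  where
  e₁ : ∀ a t → + 5 * (t * t) - (+ 2 * (a - + 0) - t) * (+ 2 * (a - + 0) - t) ≡ + 4 * ((a * t + t * t - a * a - + 1) + + 1)
  e₁ = solve-∀
  e₂ : ∀ a t → (+ 2 * ((a + + 1) - + 0) - t) - + 0 - + 1 ≡ (+ 2 * a - t - + 1) + + 2
  e₂ = solve-∀
  e₃ : ∀ a t → (+ 2 * ((a + + 1) - + 0) - t) * (+ 2 * ((a + + 1) - + 0) - t) - + 5 * (t * t) - + 1 ≡ + 4 * (a * a - a * t - t * t + + 2 * a - t) + + 3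
  e₃ = solve-∀
  a+1≰tφ : ¬ LeSqrt5 (+ 2 * ((a + + 1) - + 0) - t) t
  a+1≰tφ (inj₁ (_ , inj₁ p)) = >⇒≰ (via (e₂ a t) (t<2a f ⊕ nonneg 2)) p
  a+1≰tφ (inj₁ (_ , inj₂ p)) = >⇒≰ (via (e₃ a t) (4 · above f ⊕ nonneg 3)) p
  a+1≰tφ (inj₂ (t<0 , _))   = ≥1⇒≮0 (t≥1 f) t<0

IsFloor⇒IsFloorφ : NonNeg (t - + 1) → IsFloor a ((+ 0) + t φ) → IsFloorφ a t
IsFloor⇒IsFloorφ {t} {a} t≥1 (a≤tφ , a+1≰tφ) = isFloorφ (below′ a≤tφ) above′ t≥1
  where
  t<2a+2 : NonNeg (+ 2 * ((a + + 1) - + 0) - t - + 0 - + 1)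
  t<2a+2 with ≤-or-> (+ 2 * ((a + + 1) - + 0) - t) (+ 0)
  ... | inj₁ p = ⊥-elim (a+1≰tφ (inj₁ (≥1⇒≥0 t≥1 , inj₁ p)))
  ... | inj₂ p = p
  above′ : NonNeg (a * a - a * t - t * t + + 2 * a - t)
  above′ with ≤-or-> ((+ 2 * ((a + + 1) - + 0) - t) * (+ 2 * ((a + + 1) - + 0) - t)) (+ 5 * (t * t))
  ... | inj₁ p = ⊥-elim (a+1≰tφ (inj₁ (≥1⇒≥0 t≥1 , inj₂ p)))
  ... | inj₂ p = nonneg-÷4 (via (e a t) p)
    where
    e : ∀ a t → + 4 * (a * a - a * t - t * t + + 2 * a - t) + + 3 ≡ (+ 2 * ((a + + 1) - + 0) - t) * (+ 2 * ((a + + 1) - + 0) - t) - + 5 * (t * t) - + 1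
    e = solve-∀
  below′ : LeSqrt5 (+ 2 * (a - + 0) - t) t → NonNeg (a * t + t * t - a * a - + 1)
  below′ (inj₂ (t<0 , _)) = ⊥-elim (≥1⇒≮0 t≥1 t<0)
  below′ (inj₁ (_ , inj₂ p)) = nonneg-÷4 (via (e a t) (5q²-d²>0 (+ 2 * (a - + 0) - t) t t≥1 (ℤP.i≤j⇒0≤j-i p)))
    where
    e : ∀ a t → + 4 * (a * t + t * t - a * a - + 1) + + 3 ≡ + 5 * (t * t) - (+ 2 * (a - + 0) - t) * (+ 2 * (a - + 0) - t) - + 1
    e = solve-∀
  -- 2a ≤ t contradicts a + 1 > tφ
  below′ (inj₁ (_ , inj₁ p)) = ⊥-elim (refute 3 (4 · above′ ⊕ 2a≥0 ⊛ (2 · 2a≤t ⊕ t<2a+2 ⊕ t≥1) ⊕ 4 · 2a≤t ⊕ 4 · t²≥1) (e a t))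
    where
    2a≤t : NonNeg (t - + 2 * a)
    2a≤t = via (e′ a t) (ℤP.i≤j⇒0≤j-i p)
      where
      e′ : ∀ a t → t - + 2 * a ≡ + 0 - (+ 2 * (a - + 0) - t)
      e′ = solve-∀
    2a≥0 : NonNeg (+ 2 * a)
    2a≥0 = via (e′ a t) (t<2a+2 ⊕ t≥1)
      where
      e′ : ∀ a t → + 2 * a ≡ (+ 2 * ((a + + 1) - + 0) - t - + 0 - + 1) + (t - + 1)
      e′ = solve-∀
    t²≥1 : NonNeg (t * t - + 1)
    t²≥1 = via (e′ t) (t≥1 ⊛ (t≥1 ⊕ nonneg 2))
      where
      e′ : ∀ t → t * t - + 1 ≡ (t - + 1) * ((t - + 1) + + 2)
      e′ = solve-∀
    e : ∀ a t → + 4 * (a * a - a * t - t * t + + 2 * a - t) + ((+ 2 * a) * (+ 2 * (t - + 2 * a) + ((+ 2 * ((a + + 1) - + 0) - t - + 0 - + 1) + (t - + 1))) + (+ 4 * (t - + 2 * a) + + 4 * (t * t - + 1))) ≡ -[1+ 3 ]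
    e = solve-∀

IsFloor-unshift : IsFloor k (p + q φ) → IsFloor (k - p) ((+ 0) + q φ)
IsFloor-unshift {k} {p} {q} (lo , up) = subst (λ d → LeSqrt5 d q) (e₁ k p q) lo , λ h → up (subst (λ d → LeSqrt5 d q) (e₂ k p q) h)
  where
  e₁ : ∀ k p q → + 2 * (k - p) - q ≡ + 2 * ((k - p) - + 0) - q
  e₁ = solve-∀
  e₂ : ∀ k p q → + 2 * (((k - p) + + 1) - + 0) - q ≡ + 2 * ((k + + 1) - p) - q
  e₂ = solve-∀

IsFloor-shift : IsFloor (k - p) ((+ 0) + q φ) → IsFloor k (p + q φ)
IsFloor-shift {k} {p} {q} (lo , up) = subst (λ d → LeSqrt5 d q) (e₁ k p q) lo , λ h → up (subst (λ d → LeSqrt5 d q) (e₂ k p q) h)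
  where
  e₁ : ∀ k p q → + 2 * ((k - p) - + 0) - q ≡ + 2 * (k - p) - q
  e₁ = solve-∀
  e₂ : ∀ k p q → + 2 * ((k + + 1) - p) - q ≡ + 2 * (((k - p) + + 1) - + 0) - q
  e₂ = solve-∀

IsFloor-unique : NonNeg (q - + 1) → IsFloor x (p + q φ) → IsFloor y (p + q φ) → x ≡ y
IsFloor-unique {q} {x} {p} {y} q≥1 fx fy = begin
  x             ≡⟨ e x p ⟩
  (x - p) + p   ≡⟨ cong (_+ p) (floorφ-unique {x - p} {q} {y - p} (IsFloor⇒IsFloorφ q≥1 (IsFloor-unshift {x} {p} {q} fx)) (IsFloor⇒IsFloorφ q≥1 (IsFloor-unshift {y} {p} {q} fy))) ⟩
  (y - p) + p   ≡⟨ sym (e y p) ⟩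
  y             ∎
  where
  open ≡-Reasoning
  e : ∀ x p → x ≡ (x - p) + p
  e = solve-∀

floor-of-shifted : ∀ k p {b q} → IsFloorφ b q → k - p ≡ b → IsFloor k (p + q φ)
floor-of-shifted k p {b} {q} f k-p≡b = IsFloor-shift {k} {p} {q} (subst (λ z → IsFloor z ((+ 0) + q φ)) (sym k-p≡b) (IsFloorφ⇒IsFloor f))

-- ⌊p − qφ⌋ = p − ⌊qφ⌋ − 1, as qφ is irrational.
floor-of-shifted-neg : ∀ k p {b q} → IsFloorφ b q → p - k - + 1 ≡ b → IsFloor k (p + (- q) φ)
floor-of-shifted-neg k p {b} {q} f refl = inj₂ (≥1⇒-<0 (t≥1 f) , ℤP.0≤i-j⇒j≤i (via (e₁ k p q) (t<2a f ⊕ nonneg 3)) , ℤP.0≤i-j⇒j≤i (via (e₂ k p q) (4 · (above f ⊕ nonneg 1)))) , k+1≰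
  where
  e₁ : ∀ k p q → + 0 - (+ 2 * (k - p) - (- q)) ≡ (+ 2 * (p - k - + 1) - q - + 1) + + 3
  e₁ = solve-∀
  e₂ : ∀ k p q → (+ 2 * (k - p) - (- q)) * (+ 2 * (k - p) - (- q)) - + 5 * ((- q) * (- q)) ≡ + 4 * ((p - k - + 1) * (p - k - + 1) - (p - k - + 1) * q - q * q + + 2 * (p - k - + 1) - q + + 1)
  e₂ = solve-∀
  e₃ : ∀ q → (- q) + (q - + 1) ≡ -[1+ 0 ]
  e₃ = solve-∀
  e₄ : ∀ k p q → + 5 * ((- q) * (- q)) - (+ 2 * ((k + + 1) - p) - (- q)) * (+ 2 * ((k + + 1) - p) - (- q)) - + 1 ≡ + 4 * ((p - k - + 1) * q + q * q - (p - k - + 1) * (p - k - + 1) - + 1) + + 3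
  e₄ = solve-∀
  k+1≰ : ¬ LeSqrt5 (+ 2 * ((k + + 1) - p) - (- q)) (- q)
  k+1≰ (inj₁ (-q≥0 , _))    = refute 0 (-q≥0 ⊕ t≥1 f) (e₃ q)
  k+1≰ (inj₂ (_ , _ , 5q²≤)) = >⇒≰ (via (e₄ k p q) (4 · below f ⊕ nonneg 3)) 5q²≤

-- The Wythoff partition and descents

-- The lower and upper Wythoff sequences ⌊sφ⌋ and ⌊tφ⌋ + t = ⌊tφ²⌋.
Lower : ℤ → Set
Lower z = Σ ℤ λ s → IsFloorφ z s

Upper : ℤ → Set
Upper z = Σ ℤ λ a → Σ ℤ λ t → IsFloorφ a t × z ≡ a + t

-- With M = ⌊zφ⌋: if M − z = ⌊(2z − M)φ⌋ then z = ⌊tφ⌋ + t for t = 2z − M, and otherwise z = ⌊(M − z + 1)φ⌋.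
lower-or-upper : NonNeg (z - + 1) → Lower z ⊎ Upper z
lower-or-upper {z} z≥1 = decide (floorφ-exists z≥1)
  where
  decide : Σ ℤ (λ M → IsFloorφ M z) → Lower z ⊎ Upper z
  decide (M , f) with nonneg-or-neg (M * M - M * z - z * z + + 3 * M - + 4 * z)
  ... | inj₁ y≥0 = inj₂ (M - z , + 2 * z - M , isFloorφ (via (e₁ M z) (below f)) (via (e₂ M z) y≥0) (via (e₃ M z) (a<2t f)) , e₄ M z)
    where
    e₁ : ∀ M z → (M - z) * (+ 2 * z - M) + (+ 2 * z - M) * (+ 2 * z - M) - (M - z) * (M - z) - + 1 ≡ M * z + z * z - M * M - + 1
    e₁ = solve-∀
    e₂ : ∀ M z → (M - z) * (M - z) - (M - z) * (+ 2 * z - M) - (+ 2 * z - M) * (+ 2 * z - M) + + 2 * (M - z) - (+ 2 * z - M) ≡ M * M - M * z - z * z + + 3 * M - + 4 * z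
    e₂ = solve-∀
    e₃ : ∀ M z → (+ 2 * z - M) - + 1 ≡ + 2 * z - + 1 - M
    e₃ = solve-∀
    e₄ : ∀ M z → z ≡ (M - z) + (+ 2 * z - M)
    e₄ = solve-∀
  ... | inj₂ y<0 = inj₁ (M - z + + 1 , isFloorφ (via (e₁ M z) (above f)) (nonneg-÷4 (via (e₅ M z) (d²-5q²>0 (+ 2 * z + + 2 - (M - z + + 1)) (M - z + + 1) s≥1 (via (e₄ M z) (4 · y<0))))) s≥1)
    where
    s≥1 : NonNeg ((M - z + + 1) - + 1)
    s≥1 = via (e₃ M z) (t≤a f)
      where
      e₃ : ∀ M z → (M - z + + 1) - + 1 ≡ M - z
      e₃ = solve-∀
    e₁ : ∀ M z → z * (M - z + + 1) + (M - z + + 1) * (M - z + + 1) - z * z - + 1 ≡ M * M - M * z - z * z + + 2 * M - z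
    e₁ = solve-∀
    e₄ : ∀ M z → (+ 2 * z + + 2 - (M - z + + 1)) * (+ 2 * z + + 2 - (M - z + + 1)) - + 5 * ((M - z + + 1) * (M - z + + 1)) ≡ + 4 * (- (M * M - M * z - z * z + + 3 * M - + 4 * z) - + 1)
    e₄ = solve-∀
    e₅ : ∀ M z → + 4 * (z * z - z * (M - z + + 1) - (M - z + + 1) * (M - z + + 1) + + 2 * z - (M - z + + 1)) + + 3 ≡ (+ 2 * z + + 2 - (M - z + + 1)) * (+ 2 * z + + 2 - (M - z + + 1)) - + 5 * ((M - z + + 1) * (M - z + + 1)) - + 1
    e₅ = solve-∀

-- Computing ⌊zφ⌋ from both descriptions gives s = ⌊tφ⌋ + 1, but then ⌊sφ⌋ = z + 1.
lower-upper-disjoint : IsFloorφ z s → IsFloorφ a t → z ≡ a + t → ⊥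
lower-upper-disjoint {s = s} {a} {t} fz f refl =
  ℤP.i≢suc[i] (trans (floorφ-unique (subst (IsFloorφ (a + t)) s≡a+1 fz) (floorφ-at-lower+1 f)) (ℤP.+-comm (a + t) (+ 1)))
  where
  s≡a+1 : s ≡ a + + 1
  s≡a+1 = begin
    s                                 ≡⟨ e₁ a t s ⟩
    (a + t + s - + 1) - (a + t) + + 1 ≡⟨ cong (λ y → y - (a + t) + + 1) (floorφ-unique (floorφ-at-lower fz) (floorφ-at-upper f)) ⟩
    (+ 2 * a + t) - (a + t) + + 1     ≡⟨ e₂ a t ⟩
    a + + 1                           ∎
    where
    open ≡-Reasoning
    e₁ : ∀ a t s → s ≡ (a + t + s - + 1) - (a + t) + + 1
    e₁ = solve-∀
    e₂ : ∀ a t → (+ 2 * a + t) - (a + t) + + 1 ≡ a + + 1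
    e₂ = solve-∀

lower-injective : IsFloorφ z s → IsFloorφ z s′ → s ≡ s′
lower-injective {z} {s} {s′} f f′ = begin
  s                       ≡⟨ e z s ⟩
  (z + s - + 1) - z + + 1  ≡⟨ cong (λ y → y - z + + 1) (floorφ-unique (floorφ-at-lower f) (floorφ-at-lower f′)) ⟩
  (z + s′ - + 1) - z + + 1 ≡⟨ sym (e z s′) ⟩
  s′                      ∎
  where
  open ≡-Reasoning
  e : ∀ z s → s ≡ (z + s - + 1) - z + + 1
  e = solve-∀

upper-injective : IsFloorφ a t → IsFloorφ a′ t′ → a + t ≡ a′ + t′ → t ≡ t′
upper-injective {a} {t} {a′} {t′} f f′ eq = begin
  t                               ≡⟨ e a t ⟩
  + 2 * (a + t) - (+ 2 * a + t)    ≡⟨ cong₂ (λ x y → + 2 * x - y) eq (floorφ-unique (floorφ-at-upper f) (subst (IsFloorφ (+ 2 * a′ + t′)) (sym eq) (floorφ-at-upper f′))) ⟩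
  + 2 * (a′ + t′) - (+ 2 * a′ + t′) ≡⟨ sym (e a′ t′) ⟩
  t′                              ∎
  where
  open ≡-Reasoning
  e : ∀ a t → t ≡ + 2 * (a + t) - (+ 2 * a + t)
  e = solve-∀

data Move : Set where
  lower upper : Move

Descent : List Move → ℤ → ℤ → Set
Descent []            z t = z ≡ t
Descent (lower ∷ w) z t = Σ ℤ λ s → IsFloorφ z s × Descent w s t
Descent (upper ∷ w) z t = Σ ℤ λ a → Σ ℤ λ r → IsFloorφ a r × z ≡ a + r × Descent w r t

data Comparable : List Move → List Move → Set where
  []ˡ : ∀ {w} → Comparable [] w
  []ʳ : ∀ {w} → Comparable w []
  _∷_ : ∀ m {w w′} → Comparable w w′ → Comparable (m ∷ w) (m ∷ w′)

descent-comparable : ∀ w w′ → Descent w z t → Descent w′ z t′ → Comparable w w′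
descent-comparable []      _  _ _ = []ˡ
descent-comparable (_ ∷ _) [] _ _ = []ʳ
descent-comparable (lower ∷ w) (lower ∷ w′) (s , f , d) (s′ , f′ , d′) =
  lower ∷ descent-comparable w w′ d (subst (λ x → Descent w′ x _) (sym (lower-injective f f′)) d′)
descent-comparable (upper ∷ w) (upper ∷ w′) (a , r , f , e , d) (a′ , r′ , f′ , e′ , d′) =
  upper ∷ descent-comparable w w′ d (subst (λ x → Descent w′ x _) (sym (upper-injective f f′ (trans (sym e) e′))) d′)
descent-comparable (lower ∷ _) (upper ∷ _) (_ , f , _) (_ , _ , f′ , e , _) = ⊥-elim (lower-upper-disjoint f f′ e)
descent-comparable (upper ∷ _) (lower ∷ _) (_ , _ , f , e , _) (_ , f′ , _) = ⊥-elim (lower-upper-disjoint f′ f e)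

descent-functional : ∀ w → Descent w z t → Descent w z t′ → t ≡ t′
descent-functional [] refl refl = refl
descent-functional (lower ∷ w) (s , f , d) (s′ , f′ , d′) =
  descent-functional w d (subst (λ x → Descent w x _) (sym (lower-injective f f′)) d′)
descent-functional (upper ∷ w) (a , r , f , e , d) (a′ , r′ , f′ , e′ , d′) =
  descent-functional w d (subst (λ x → Descent w x _) (sym (upper-injective f f′ (trans (sym e) e′))) d′)

-- The five classes

-- R₁₀, R₂₂, R₃₁, R₃₂, R₄₀ partition ℕ; R₂₀ = R₃₂ ∪ R₄₀ and R₁₁ = R₂₂ ∪ R₃₁.
data Class : Set where
  R₁₀ R₂₂ R₃₁ R₃₂ R₄₀ : Class

private variable
  c c′ : Class

-- F(i + 1) a + F(i) t − j for the class R_{i,j}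
form : Class → ℤ → ℤ → ℤ
form R₁₀ a t = a + t
form R₂₂ a t = + 2 * a + t - + 2
form R₃₁ a t = + 3 * a + + 2 * t - + 1
form R₃₂ a t = + 3 * a + + 2 * t - + 2
form R₄₀ a t = + 5 * a + + 3 * t

record InClass (c : Class) (z : ℤ) : Set where
  constructor inClass
  field
    aₙ n    : ℤ
    isFloor : IsFloorφ aₙ n
    z≡form  : z ≡ form c aₙ n

address : Class → List Move
address R₁₀ = upper ∷ []
address R₂₂ = lower ∷ lower ∷ lower ∷ []
address R₃₁ = lower ∷ lower ∷ upper ∷ []
address R₃₂ = lower ∷ upper ∷ lower ∷ []
address R₄₀ = lower ∷ upper ∷ upper ∷ []

address-prefix-free : ∀ c c′ → Comparable (address c) (address c′) → c ≡ c′
address-prefix-free R₁₀ R₁₀ _ = refl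
address-prefix-free R₂₂ R₂₂ _ = refl
address-prefix-free R₃₁ R₃₁ _ = refl
address-prefix-free R₃₂ R₃₂ _ = refl
address-prefix-free R₄₀ R₄₀ _ = refl
address-prefix-free R₁₀ R₂₂ ()
address-prefix-free R₁₀ R₃₁ ()
address-prefix-free R₁₀ R₃₂ ()
address-prefix-free R₁₀ R₄₀ ()
address-prefix-free R₂₂ R₁₀ ()
address-prefix-free R₃₁ R₁₀ ()
address-prefix-free R₃₂ R₁₀ ()
address-prefix-free R₄₀ R₁₀ ()
address-prefix-free R₂₂ R₃₁ (_ ∷ _ ∷ ())
address-prefix-free R₂₂ R₃₂ (_ ∷ ())
address-prefix-free R₂₂ R₄₀ (_ ∷ ())
address-prefix-free R₃₁ R₂₂ (_ ∷ _ ∷ ())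
address-prefix-free R₃₁ R₃₂ (_ ∷ ())
address-prefix-free R₃₁ R₄₀ (_ ∷ ())
address-prefix-free R₃₂ R₂₂ (_ ∷ ())
address-prefix-free R₃₂ R₃₁ (_ ∷ ())
address-prefix-free R₃₂ R₄₀ (_ ∷ _ ∷ ())
address-prefix-free R₄₀ R₂₂ (_ ∷ ())
address-prefix-free R₄₀ R₃₁ (_ ∷ ())
address-prefix-free R₄₀ R₃₂ (_ ∷ _ ∷ ())

floorφ-R₂₂ : IsFloorφ a t → IsFloorφ (form R₂₂ a t) (a + t - + 1)
floorφ-R₂₂ {a} {t} f = subst (λ z → IsFloorφ z (a + t - + 1)) (e a t) (floorφ-at-lower (floorφ-at-lower f))
  where
  e : ∀ a t → (a + t - + 1) + a - + 1 ≡ + 2 * a + t - + 2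
  e = solve-∀

floorφ-R₃₁ : IsFloorφ a t → IsFloorφ (form R₃₁ a t) (+ 2 * a + t)
floorφ-R₃₁ {a} {t} f = subst (λ z → IsFloorφ z (+ 2 * a + t)) (e a t) (floorφ-at-lower (floorφ-at-upper f))
  where
  e : ∀ a t → (+ 2 * a + t) + (a + t) - + 1 ≡ + 3 * a + + 2 * t - + 1
  e = solve-∀

floorφ-R₃₂ : IsFloorφ a t → IsFloorφ (form R₃₂ a t) ((a + t - + 1) + a)
floorφ-R₃₂ {a} {t} f = subst (λ z → IsFloorφ z ((a + t - + 1) + a)) (e a t) (floorφ-at-upper (floorφ-at-lower f))
  where
  e : ∀ a t → + 2 * (a + t - + 1) + a ≡ + 3 * a + + 2 * t - + 2
  e = solve-∀

floorφ-R₄₀ : IsFloorφ a t → IsFloorφ (form R₄₀ a t) ((+ 2 * a + t) + (a + t))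
floorφ-R₄₀ {a} {t} f = subst (λ z → IsFloorφ z ((+ 2 * a + t) + (a + t))) (e a t) (floorφ-at-upper (floorφ-at-upper f))
  where
  e : ∀ a t → + 2 * (+ 2 * a + t) + (a + t) ≡ + 5 * a + + 3 * t
  e = solve-∀

form-descent : ∀ c → IsFloorφ a t → Descent (address c) (form c a t) t
form-descent {a} {t} R₁₀ f = a , t , f , refl , refl
form-descent {a} {t} R₂₂ f = a + t - + 1 , floorφ-R₂₂ f , a , floorφ-at-lower f , t , f , refl
form-descent {a} {t} R₃₁ f = + 2 * a + t , floorφ-R₃₁ f , a + t , floorφ-at-upper f , a , t , f , refl , refl
form-descent {a} {t} R₃₂ f = (a + t - + 1) + a , floorφ-R₃₂ f , a + t - + 1 , a , floorφ-at-lower f , refl , t , f , refl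
form-descent {a} {t} R₄₀ f = (+ 2 * a + t) + (a + t) , floorφ-R₄₀ f , + 2 * a + t , a + t , floorφ-at-upper f , refl , a , t , f , refl , refl

descent-form : ∀ c → Descent (address c) z t → InClass c z
descent-form R₁₀ (a , t , f , z≡a+t , refl) = inClass a t f z≡a+t
descent-form {z} R₂₂ (s , fz , r , fs , t , fr , refl) = inClass r t fr (begin
  z                        ≡⟨ floorφ-unique fz (floorφ-at-lower fs) ⟩
  s + r - + 1              ≡⟨ cong (λ x → x + r - + 1) (floorφ-unique fs (floorφ-at-lower fr)) ⟩
  (r + t - + 1) + r - + 1  ≡⟨ e r t ⟩
  + 2 * r + t - + 2        ∎)
  where
  open ≡-Reasoning
  e : ∀ r t → (r + t - + 1) + r - + 1 ≡ + 2 * r + t - + 2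
  e = solve-∀
descent-form {z} R₃₁ (s , fz , r , fs , a , t , fa , r≡a+t , refl) = inClass a t fa (begin
  z                             ≡⟨ floorφ-unique fz (floorφ-at-lower fs) ⟩
  s + r - + 1                   ≡⟨ cong₂ (λ x y → x + y - + 1) (floorφ-unique fs (subst (IsFloorφ (+ 2 * a + t)) (sym r≡a+t) (floorφ-at-upper fa))) r≡a+t ⟩
  (+ 2 * a + t) + (a + t) - + 1 ≡⟨ e a t ⟩
  + 3 * a + + 2 * t - + 1       ∎)
  where
  open ≡-Reasoning
  e : ∀ a t → (+ 2 * a + t) + (a + t) - + 1 ≡ + 3 * a + + 2 * t - + 1
  e = solve-∀
descent-form {z} R₃₂ (s , fz , b , r , fb , s≡b+r , t , fr , refl) = inClass r t fr (begin
  z                         ≡⟨ floorφ-unique fz (subst (IsFloorφ (+ 2 * b + r)) (sym s≡b+r) (floorφ-at-upper fb)) ⟩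
  + 2 * b + r               ≡⟨ cong (λ x → + 2 * x + r) (floorφ-unique fb (floorφ-at-lower fr)) ⟩
  + 2 * (r + t - + 1) + r   ≡⟨ e r t ⟩
  + 3 * r + + 2 * t - + 2   ∎)
  where
  open ≡-Reasoning
  e : ∀ r t → + 2 * (r + t - + 1) + r ≡ + 3 * r + + 2 * t - + 2
  e = solve-∀
descent-form {z} R₄₀ (s , fz , b , r , fb , s≡b+r , a , t , fa , r≡a+t , refl) = inClass a t fa (begin
  z                             ≡⟨ floorφ-unique fz (subst (IsFloorφ (+ 2 * b + r)) (sym s≡b+r) (floorφ-at-upper fb)) ⟩
  + 2 * b + r                   ≡⟨ cong₂ (λ x y → + 2 * x + y) (floorφ-unique fb (subst (IsFloorφ (+ 2 * a + t)) (sym r≡a+t) (floorφ-at-upper fa))) r≡a+t ⟩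
  + 2 * (+ 2 * a + t) + (a + t) ≡⟨ e a t ⟩
  + 5 * a + + 3 * t             ∎)
  where
  open ≡-Reasoning
  e : ∀ a t → + 2 * (+ 2 * a + t) + (a + t) ≡ + 5 * a + + 3 * t
  e = solve-∀

descend : NonNeg (z - + 1) → Σ Class λ c → Σ ℤ λ t → Descent (address c) z t
descend {z} z≥1 = from-z (lower-or-upper z≥1)
  where
  from-z : Lower z ⊎ Upper z → Σ Class λ c → Σ ℤ λ t → Descent (address c) z t
  from-z (inj₂ (a , t , f , z≡)) = R₁₀ , t , a , t , f , z≡ , refl
  from-z (inj₁ (s , fz)) = from-s (lower-or-upper (t≥1 fz))
    where
    from-s : Lower s ⊎ Upper s → Σ Class λ c → Σ ℤ λ t → Descent (address c) z t
    from-s (inj₁ (r , fs)) = from-r (lower-or-upper (t≥1 fs))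
      where
      from-r : Lower r ⊎ Upper r → Σ Class λ c → Σ ℤ λ t → Descent (address c) z t
      from-r (inj₁ (t , fr))           = R₂₂ , t , s , fz , r , fs , t , fr , refl
      from-r (inj₂ (a , t , fa , r≡)) = R₃₁ , t , s , fz , r , fs , a , t , fa , r≡ , refl
    from-s (inj₂ (b , r , fb , s≡)) = from-r (lower-or-upper (t≥1 fb))
      where
      from-r : Lower r ⊎ Upper r → Σ Class λ c → Σ ℤ λ t → Descent (address c) z t
      from-r (inj₁ (t , fr))           = R₃₂ , t , s , fz , b , r , fb , s≡ , t , fr , refl
      from-r (inj₂ (a , t , fa , r≡)) = R₄₀ , t , s , fz , b , r , fb , s≡ , a , t , fa , r≡ , refl

classify : NonNeg (z - + 1) → Σ Class λ c → InClass c z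
classify {z} z≥1 = let c , t , d = descend {z} z≥1 in c , descent-form {z} {t} c d

inClass-unique : (p : InClass c z) (p′ : InClass c′ z) → (c , InClass.aₙ p , InClass.n p) ≡ (c′ , InClass.aₙ p′ , InClass.n p′)
inClass-unique {c} {z} {c′} (inClass a t f z≡) (inClass a′ t′ f′ z≡′) = cong₂ _,_ c≡c′ (cong₂ _,_ a≡a′ t≡t′)
  where
  d : Descent (address c) z t
  d = subst (λ x → Descent (address c) x t) (sym z≡) (form-descent c f)
  d′ : Descent (address c′) z t′
  d′ = subst (λ x → Descent (address c′) x t′) (sym z≡′) (form-descent c′ f′)
  c≡c′ : c ≡ c′
  c≡c′ = address-prefix-free c c′ (descent-comparable (address c) (address c′) d d′)
  t≡t′ : t ≡ t′
  t≡t′ = descent-functional (address c) d (subst (λ c → Descent (address c) z t′) (sym c≡c′) d′)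
  a≡a′ : a ≡ a′
  a≡a′ = floorφ-unique f (subst (IsFloorφ a′) (sym t≡t′) f′)

R-index : Class → ℕ
R-index R₁₀ = 1
R-index R₂₂ = 2
R-index R₃₁ = 3
R-index R₃₂ = 3
R-index R₄₀ = 4

R-shift : Class → ℤ
R-shift R₁₀ = + 0
R-shift R₂₂ = + 2
R-shift R₃₁ = + 1
R-shift R₃₂ = + 2
R-shift R₄₀ = + 0

R-form : ∀ c a t → + F (suc (R-index c)) * a + + F (R-index c) * t - R-shift c ≡ form c a t
R-form R₁₀ = e
  where
  e : ∀ a t → + 1 * a + + 1 * t - + 0 ≡ a + t
  e = solve-∀
R-form R₂₂ = e
  where
  e : ∀ a t → + 2 * a + + 1 * t - + 2 ≡ + 2 * a + t - + 2
  e = solve-∀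
R-form R₃₁ _ _ = refl
R-form R₃₂ _ _ = refl
R-form R₄₀ = e
  where
  e : ∀ a t → + 5 * a + + 3 * t - + 0 ≡ + 5 * a + + 3 * t
  e = solve-∀

1≤⇒≥1 : 1 ℕ.≤ m → NonNeg (+ m - + 1)
1≤⇒≥1 {suc m} _ = nonneg m

≥1⇒1≤ : NonNeg (+ m - + 1) → 1 ℕ.≤ m
≥1⇒1≤ {suc m} _ = s≤s z≤n

InR⇒params : InR i j m → Σ ℤ λ a → Σ ℤ λ t → IsFloorφ a t × + m ≡ + F (suc i) * a + + F i * t - j
InR⇒params (t , a , t≥1 , fl , eq) = + a , + t , IsFloor⇒IsFloorφ (1≤⇒≥1 t≥1) fl , eq

params⇒InR : IsFloorφ a t → + m ≡ + F (suc i) * a + + F i * t - j → InR i j m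
params⇒InR {a} {t} {m} {i} {j} f eq =
  ∣ t ∣ , ∣ a ∣ , ≥1⇒1≤ (subst (λ x → NonNeg (x - + 1)) (sym ∣t∣≡t) (t≥1 f)) ,
  subst₂ (λ a t → IsFloor a ((+ 0) + t φ)) (sym ∣a∣≡a) (sym ∣t∣≡t) (IsFloorφ⇒IsFloor f) ,
  subst₂ (λ a t → + m ≡ + F (suc i) * a + + F i * t - j) (sym ∣a∣≡a) (sym ∣t∣≡t) eq
  where
  ∣a∣≡a : + ∣ a ∣ ≡ a
  ∣a∣≡a = ℤP.0≤i⇒+∣i∣≡i (≥1⇒≥0 (a≥1 f))
  ∣t∣≡t : + ∣ t ∣ ≡ t
  ∣t∣≡t = ℤP.0≤i⇒+∣i∣≡i (≥1⇒≥0 (t≥1 f))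

InR⇒InClass : ∀ c → InR (R-index c) (R-shift c) m → InClass c (+ m)
InR⇒InClass c w = let a , t , f , eq = InR⇒params {R-index c} {R-shift c} w in inClass a t f (trans eq (R-form c a t))

InClass⇒InR : ∀ c → InClass c (+ m) → InR (R-index c) (R-shift c) m
InClass⇒InR c (inClass a t f eq) = params⇒InR {i = R-index c} {j = R-shift c} f (trans eq (sym (R-form c a t)))

form-≥1 : ∀ c → IsFloorφ a t → NonNeg (form c a t - + 1)
form-≥1 {a} {t} R₁₀ f = via (e a t) (t≤a f ⊕ 2 · t≥1 f ⊕ nonneg 1)
  where
  e : ∀ a t → a + t - + 1 ≡ (a - t) + (+ 2 * (t - + 1) + + 1)
  e = solve-∀
form-≥1 {a} {t} R₂₂ f = via (e a t) (2 · t≤a f ⊕ 3 · t≥1 f)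
  where
  e : ∀ a t → + 2 * a + t - + 2 - + 1 ≡ + 2 * (a - t) + + 3 * (t - + 1)
  e = solve-∀
form-≥1 {a} {t} R₃₁ f = via (e a t) (3 · t≤a f ⊕ 5 · t≥1 f ⊕ nonneg 3)
  where
  e : ∀ a t → + 3 * a + + 2 * t - + 1 - + 1 ≡ + 3 * (a - t) + (+ 5 * (t - + 1) + + 3)
  e = solve-∀
form-≥1 {a} {t} R₃₂ f = via (e a t) (3 · t≤a f ⊕ 5 · t≥1 f ⊕ nonneg 2)
  where
  e : ∀ a t → + 3 * a + + 2 * t - + 2 - + 1 ≡ + 3 * (a - t) + (+ 5 * (t - + 1) + + 2)
  e = solve-∀
form-≥1 {a} {t} R₄₀ f = via (e a t) (5 · t≤a f ⊕ 8 · t≥1 f ⊕ nonneg 7)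
  where
  e : ∀ a t → + 5 * a + + 3 * t - + 1 ≡ + 5 * (a - t) + (+ 8 * (t - + 1) + + 7)
  e = solve-∀

InClass-≥1 : InClass c z → NonNeg (z - + 1)
InClass-≥1 {c} (inClass a t f refl) = form-≥1 c f

classify-along : ∀ w → Descent (lower ∷ w) z t → Σ Class λ c → Comparable (lower ∷ w) (address c) × InClass c z
classify-along {z} w d@(_ , f , _) = let c , t′ , d′ = descend {z} (a≥1 f) in c , descent-comparable (lower ∷ w) (address c) d d′ , descent-form {z} {t′} c d′

-- R₂₀ consists of the z = ⌊(b + r)φ⌋ with b = ⌊rφ⌋.
R₂₀-split : IsFloorφ b r → z ≡ + 2 * b + r → InClass R₃₂ z ⊎ InClass R₄₀ z
R₂₀-split {b} {r} f refl = pick (classify-along (upper ∷ []) (b + r , floorφ-at-upper f , b , r , f , refl , refl))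
  where
  pick : Σ Class (λ c → Comparable (lower ∷ upper ∷ []) (address c) × InClass c (+ 2 * b + r)) → InClass R₃₂ (+ 2 * b + r) ⊎ InClass R₄₀ (+ 2 * b + r)
  pick (R₃₂ , _ , p)        = inj₁ p
  pick (R₄₀ , _ , p)        = inj₂ p
  pick (R₁₀ , () , _)
  pick (R₂₂ , (_ ∷ ()) , _)
  pick (R₃₁ , (_ ∷ ()) , _)

-- R₁₁ consists of the z = ⌊bφ⌋ with b = ⌊rφ⌋.
R₁₁-split : IsFloorφ b r → z ≡ b + r - + 1 → InClass R₂₂ z ⊎ InClass R₃₁ z
R₁₁-split {b} {r} f refl = pick (classify-along (lower ∷ []) (b , floorφ-at-lower f , r , f , refl))
  where
  pick : Σ Class (λ c → Comparable (lower ∷ lower ∷ []) (address c) × InClass c (b + r - + 1)) → InClass R₂₂ (b + r - + 1) ⊎ InClass R₃₁ (b + r - + 1)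
  pick (R₂₂ , _ , p)        = inj₁ p
  pick (R₃₁ , _ , p)        = inj₂ p
  pick (R₁₀ , () , _)
  pick (R₃₂ , (_ ∷ ()) , _)
  pick (R₄₀ , (_ ∷ ()) , _)

InR₂₀-split : InR 2 (+ 0) m → InClass R₃₂ (+ m) ⊎ InClass R₄₀ (+ m)
InR₂₀-split w = let b , r , f , eq = InR⇒params {2} {+ 0} w in R₂₀-split f (trans eq (e b r))
  where
  e : ∀ b r → + 2 * b + + 1 * r - + 0 ≡ + 2 * b + r
  e = solve-∀

InR₁₁-split : InR 1 (+ 1) m → InClass R₂₂ (+ m) ⊎ InClass R₃₁ (+ m)
InR₁₁-split w = let b , r , f , eq = InR⇒params {1} {+ 1} w in R₁₁-split f (trans eq (e b r))
  where
  e : ∀ b r → + 1 * b + + 1 * r - + 1 ≡ b + r - + 1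
  e = solve-∀

R₃₂⊆R₂₀ : InClass R₃₂ (+ m) → InR 2 (+ 0) m
R₃₂⊆R₂₀ (inClass a t f eq) = params⇒InR {i = 2} {j = + 0} (floorφ-at-lower f) (trans eq (e a t))
  where
  e : ∀ a t → + 3 * a + + 2 * t - + 2 ≡ + 2 * (a + t - + 1) + + 1 * a - + 0
  e = solve-∀

R₄₀⊆R₂₀ : InClass R₄₀ (+ m) → InR 2 (+ 0) m
R₄₀⊆R₂₀ (inClass a t f eq) = params⇒InR {i = 2} {j = + 0} (floorφ-at-upper f) (trans eq (e a t))
  where
  e : ∀ a t → + 5 * a + + 3 * t ≡ + 2 * (+ 2 * a + t) + + 1 * (a + t) - + 0
  e = solve-∀

-- The permutation ι

next : Class → Class
next R₁₀ = R₃₂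
next R₃₂ = R₂₂
next R₂₂ = R₁₀
next R₃₁ = R₄₀
next R₄₀ = R₃₁

next^ : ℕ → Class → Class
next^ zero    c = c
next^ (suc k) c = next (next^ k c)

next^6 : ∀ c → next^ 6 c ≡ c
next^6 R₁₀ = refl
next^6 R₂₂ = refl
next^6 R₃₁ = refl
next^6 R₃₂ = refl
next^6 R₄₀ = refl

ιOffset : Class → ℤ → ℤ
ιOffset R₁₀ z = z - + 2
ιOffset R₃₁ z = + 2
ιOffset R₂₂ z = + 2 - z
ιOffset R₃₂ z = - z
ιOffset R₄₀ z = - z

ιShape : Class → ℤ → Zφ
ιShape c z = ιOffset c z + z φ

ι-floor : ∀ c → IsFloorφ a t → IsFloor (form (next c) a t) (ιShape c (form c a t))
ι-floor {a} {t} R₁₀ f = floor-of-shifted (form R₃₂ a t) (form R₁₀ a t - + 2) (floorφ-at-upper f) (e a t)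
  where
  e : ∀ a t → (+ 3 * a + + 2 * t - + 2) - ((a + t) - + 2) ≡ + 2 * a + t
  e = solve-∀
ι-floor {a} {t} R₂₂ f = floor-of-shifted (form R₁₀ a t) (+ 2 - form R₂₂ a t) (floorφ-at-lower (floorφ-R₂₂ f)) (e a t)
  where
  e : ∀ a t → (a + t) - (+ 2 - (+ 2 * a + t - + 2)) ≡ (+ 2 * a + t - + 2) + (a + t - + 1) - + 1
  e = solve-∀
ι-floor {a} {t} R₃₁ f = floor-of-shifted (form R₄₀ a t) (+ 2) (floorφ-at-lower (floorφ-R₃₁ f)) (e a t)
  where
  e : ∀ a t → (+ 5 * a + + 3 * t) - + 2 ≡ (+ 3 * a + + 2 * t - + 1) + (+ 2 * a + t) - + 1
  e = solve-∀
ι-floor {a} {t} R₃₂ f = floor-of-shifted (form R₂₂ a t) (- form R₃₂ a t) (floorφ-at-lower (floorφ-R₃₂ f)) (e a t)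
  where
  e : ∀ a t → (+ 2 * a + t - + 2) - (- (+ 3 * a + + 2 * t - + 2)) ≡ (+ 3 * a + + 2 * t - + 2) + ((a + t - + 1) + a) - + 1
  e = solve-∀
ι-floor {a} {t} R₄₀ f = floor-of-shifted (form R₃₁ a t) (- form R₄₀ a t) (floorφ-at-lower (floorφ-R₄₀ f)) (e a t)
  where
  e : ∀ a t → (+ 3 * a + + 2 * t - + 1) - (- (+ 5 * a + + 3 * t)) ≡ (+ 5 * a + + 3 * t) + ((+ 2 * a + t) + (a + t)) - + 1
  e = solve-∀

⌊φn+2⌋-R₂₂ : IsFloorφ a t → IsFloor (form R₃₂ a t) ((+ 2) + (form R₂₂ a t) φ)
⌊φn+2⌋-R₂₂ {a} {t} f = floor-of-shifted (form R₃₂ a t) (+ 2) (floorφ-at-lower (floorφ-R₂₂ f)) (e a t)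
  where
  e : ∀ a t → (+ 3 * a + + 2 * t - + 2) - + 2 ≡ (+ 2 * a + t - + 2) + (a + t - + 1) - + 1
  e = solve-∀

⌊φn-2⌋-R₁₀ : IsFloorφ a t → IsFloor (form R₂₂ a t) ((- (+ 2)) + (form R₁₀ a t) φ)
⌊φn-2⌋-R₁₀ {a} {t} f = floor-of-shifted (form R₂₂ a t) (- (+ 2)) (floorφ-at-upper f) (e a t)
  where
  e : ∀ a t → (+ 2 * a + t - + 2) - (- (+ 2)) ≡ + 2 * a + t
  e = solve-∀

⌊2n+1-φn⌋-R₃₂ : IsFloorφ a t → IsFloor (form R₁₀ a t) ((+ 2 * form R₃₂ a t + + 1) + (- form R₃₂ a t) φ)
⌊2n+1-φn⌋-R₃₂ {a} {t} f = floor-of-shifted-neg (form R₁₀ a t) (+ 2 * form R₃₂ a t + + 1) (floorφ-at-lower (floorφ-R₃₂ f)) (e a t)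
  where
  e : ∀ a t → (+ 2 * (+ 3 * a + + 2 * t - + 2) + + 1) - (a + t) - + 1 ≡ (+ 3 * a + + 2 * t - + 2) + ((a + t - + 1) + a) - + 1
  e = solve-∀

ShapeSpec : (ℕ → ℕ) → Set
ShapeSpec ι = ∀ {c n} → InClass c (+ n) → IsFloor (+ ι n) (ιShape c (+ n))

InClass⇒1≤ : InClass c (+ m) → 1 ℕ.≤ m
InClass⇒1≤ p = ≥1⇒1≤ (InClass-≥1 p)

IotaSpec⇒ShapeSpec : ∀ {ι} → IotaSpec ι → ShapeSpec ι
IotaSpec⇒ShapeSpec spec {R₁₀} {n} p = proj₁ (spec n (InClass⇒1≤ p)) (InClass⇒InR R₁₀ p)
IotaSpec⇒ShapeSpec spec {R₃₁} {n} p = proj₁ (proj₂ (spec n (InClass⇒1≤ p))) (InClass⇒InR R₃₁ p)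
IotaSpec⇒ShapeSpec spec {R₂₂} {n} p = proj₁ (proj₂ (proj₂ (spec n (InClass⇒1≤ p)))) (InClass⇒InR R₂₂ p)
IotaSpec⇒ShapeSpec spec {R₃₂} {n} p = proj₂ (proj₂ (proj₂ (spec n (InClass⇒1≤ p)))) (R₃₂⊆R₂₀ p)
IotaSpec⇒ShapeSpec spec {R₄₀} {n} p = proj₂ (proj₂ (proj₂ (spec n (InClass⇒1≤ p)))) (R₄₀⊆R₂₀ p)

ShapeSpec⇒IotaSpec : ∀ {ι} → ShapeSpec ι → IotaSpec ι
ShapeSpec⇒IotaSpec shape n _ =
  shape ∘ InR⇒InClass R₁₀ , shape ∘ InR⇒InClass R₃₁ , shape ∘ InR⇒InClass R₂₂ , [ shape , shape ]′ ∘ InR₂₀-split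

ιValue : ∀ {z} → Σ Class (λ c → InClass c z) → ℤ
ιValue (c , p) = form (next c) (InClass.aₙ p) (InClass.n p)

ι₀ : ℕ → ℕ
ι₀ zero    = zero  -- ι is only specified on n ≥ 1
ι₀ (suc m) = ∣ ιValue (classify {+ suc m} (nonneg m)) ∣

ι₀-shape : ShapeSpec ι₀
ι₀-shape {n = zero} p = ⊥-elim (ℕP.1+n≰n (InClass⇒1≤ p))
ι₀-shape {c} {suc m} p@(inClass a t f eq) =
  subst₂ IsFloor (sym ι₀≡) (cong (ιShape c) (sym eq)) (ι-floor c f)
  where
  classified : Σ Class λ c → InClass c (+ suc m)
  classified = classify (nonneg m)
  ι₀≡ : + ι₀ (suc m) ≡ form (next c) a t
  ι₀≡ = trans (ℤP.0≤i⇒+∣i∣≡i (≥1⇒≥0 (form-≥1 (next (proj₁ classified)) (InClass.isFloor (proj₂ classified)))))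
              (cong (λ { (c , a , t) → form (next c) a t }) (inClass-unique (proj₂ classified) p))

module Dynamics (ι : ℕ → ℕ) (shape : ShapeSpec ι) where

  ι-step : IsFloorφ a t → + m ≡ form c a t → + ι m ≡ form (next c) a t
  ι-step {a} {t} {m} {c} f eq =
    IsFloor-unique (subst (λ z → NonNeg (z - + 1)) (sym eq) (form-≥1 c f))
      (shape {c} {m} (inClass a t f eq)) (subst (IsFloor (form (next c) a t) ∘ ιShape c) (sym eq) (ι-floor c f))

  ι-iterate : ∀ k → IsFloorφ a t → + m ≡ form c a t → + (ι ^[ k ]) m ≡ form (next^ k c) a t
  ι-iterate zero    f eq = eq
  ι-iterate {c = c} (suc k) f eq = ι-step {c = next^ k c} f (ι-iterate k f eq)

  power-floor : ∀ k (r : ℤ → Zφ) → (∀ {a t} → IsFloorφ a t → IsFloor (form (next^ k c) a t) (r (form c a t))) →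
                InClass c (+ m) → IsFloor (+ (ι ^[ k ]) m) (r (+ m))
  power-floor {c} k r floor-fact (inClass a t f eq) = subst₂ IsFloor (sym (ι-iterate {c = c} k f eq)) (cong r (sym eq)) (floor-fact f)

  power-fixed : ∀ k → next^ k c ≡ c → InClass c (+ m) → (ι ^[ k ]) m ≡ m
  power-fixed {c} k cycle (inClass a t f eq) =
    ℤP.+-injective (trans (ι-iterate {c = c} k f eq) (trans (cong (λ c → form c a t) cycle) (sym eq)))

  ι^6≡id : ∀ m → 1 ℕ.≤ m → (ι ^[ 6 ]) m ≡ m
  ι^6≡id m m≥1 = let c , p = classify (1≤⇒≥1 m≥1) in power-fixed 6 (next^6 c) p

  ι-≥1 : ∀ m → 1 ℕ.≤ m → 1 ℕ.≤ ι m
  ι-≥1 m m≥1 = let c , inClass a t f eq = classify (1≤⇒≥1 m≥1) in ≥1⇒1≤ (subst (λ z → NonNeg (z - + 1)) (sym (ι-step {c = c} f eq)) (form-≥1 (next c) f))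

  ι^[k]∘ι : ∀ k m → (ι ^[ k ]) (ι m) ≡ (ι ^[ suc k ]) m
  ι^[k]∘ι zero    m = refl
  ι^[k]∘ι (suc k) m = cong ι (ι^[k]∘ι k m)

  ι-permutation : IsPermPos ι
  ι-permutation = ι-≥1 , injective , surjective
    where
    injective : ∀ m n → 1 ℕ.≤ m → 1 ℕ.≤ n → ι m ≡ ι n → m ≡ n
    injective m n m≥1 n≥1 eq = begin
      m                  ≡⟨ sym (ι^6≡id m m≥1) ⟩
      (ι ^[ 6 ]) m       ≡⟨ sym (ι^[k]∘ι 5 m) ⟩
      (ι ^[ 5 ]) (ι m)   ≡⟨ cong (ι ^[ 5 ]) eq ⟩
      (ι ^[ 5 ]) (ι n)   ≡⟨ ι^[k]∘ι 5 n ⟩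
      (ι ^[ 6 ]) n       ≡⟨ ι^6≡id n n≥1 ⟩
      n                  ∎
      where open ≡-Reasoning
    surjective : ∀ m → 1 ℕ.≤ m → Σ ℕ λ n → 1 ℕ.≤ n × ι n ≡ m
    surjective m m≥1 = (ι ^[ 5 ]) m , iterate-≥1 5 , ι^6≡id m m≥1
      where
      iterate-≥1 : ∀ k → 1 ℕ.≤ (ι ^[ k ]) m
      iterate-≥1 zero    = m≥1
      iterate-≥1 (suc k) = ι-≥1 _ (iterate-≥1 k)

  ι-order-6 : HasOrder6 ι
  ι-order-6 = ι^6≡id , not-earlier
    where
    ⌊φ⌋≡1 : IsFloorφ (+ 1) (+ 1)
    ⌊φ⌋≡1 = isFloorφ (nonneg 0) (nonneg 0) (nonneg 0)
    moved : ∀ k c → + m ≡ form c (+ 1) (+ 1) → + m ≢ form (next^ k c) (+ 1) (+ 1) → (ι ^[ k ]) m ≢ m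
    moved k c eq ne ι^k≡id = ne (trans (cong +_ (sym ι^k≡id)) (ι-iterate {c = c} k ⌊φ⌋≡1 eq))
    -- the orbits 2 → 3 → 1 → 2 in R₁₀ → R₃₂ → R₂₂ and 4 → 8 → 4 in R₃₁ → R₄₀
    not-earlier : ∀ k → 1 ℕ.≤ k → k ℕ.< 6 → Σ ℕ λ m → 1 ℕ.≤ m × (ι ^[ k ]) m ≢ m
    not-earlier 1 _ _ = 2 , s≤s z≤n , moved 1 R₁₀ refl λ ()
    not-earlier 2 _ _ = 2 , s≤s z≤n , moved 2 R₁₀ refl λ ()
    not-earlier 3 _ _ = 4 , s≤s z≤n , moved 3 R₃₁ refl λ ()
    not-earlier 4 _ _ = 2 , s≤s z≤n , moved 4 R₁₀ refl λ ()
    not-earlier 5 _ _ = 2 , s≤s z≤n , moved 5 R₁₀ refl λ ()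
    not-earlier (suc (suc (suc (suc (suc (suc _)))))) _ (s≤s (s≤s (s≤s (s≤s (s≤s (s≤s ()))))))

  ι-powers : PowerFormulas ι
  ι-powers m m≥1 =
    ( floor-on 2 R₂₂ (λ z → (+ 2) + z φ) ⌊φn+2⌋-R₂₂
    , floor-on 2 R₁₀ (λ z → (- (+ 2)) + z φ) ⌊φn-2⌋-R₁₀
    , [ fixed-on 2 R₄₀ refl , fixed-on 2 R₃₁ refl ]′
    , floor-on 2 R₃₂ (λ z → (+ 2 * z + + 1) + (- z) φ) ⌊2n+1-φn⌋-R₃₂ )
    , ( floor-on 3 R₃₁ (ιShape R₃₁) (ι-floor R₃₁)
      , floor-on 3 R₄₀ (ιShape R₄₀) (ι-floor R₄₀)
      , [ fixed-on 3 R₃₂ refl , [ fixed-on 3 R₂₂ refl , fixed-on 3 R₁₀ refl ]′ ]′ )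
    , ( floor-on 4 R₁₀ (ιShape R₁₀) (ι-floor R₁₀)
      , floor-on 4 R₂₂ (ιShape R₂₂) (ι-floor R₂₂)
      , floor-on 4 R₃₂ (ιShape R₃₂) (ι-floor R₃₂)
      , [ fixed-on 4 R₄₀ refl , fixed-on 4 R₃₁ refl ]′ )
    , ( ι^6≡id m m≥1
      , [ power-floor 5 (λ z → (+ 2) + z φ) ⌊φn+2⌋-R₂₂ , power-floor 5 (ιShape R₃₁) (ι-floor R₃₁) ]′ ∘ InR₁₁-split
      , floor-on 5 R₁₀ (λ z → (- (+ 2)) + z φ) ⌊φn-2⌋-R₁₀
      , floor-on 5 R₄₀ (ιShape R₄₀) (ι-floor R₄₀)
      , floor-on 5 R₃₂ (λ z → (+ 2 * z + + 1) + (- z) φ) ⌊2n+1-φn⌋-R₃₂ )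
    where
    floor-on : ∀ k c (r : ℤ → Zφ) → (∀ {a t} → IsFloorφ a t → IsFloor (form (next^ k c) a t) (r (form c a t))) →
               InR (R-index c) (R-shift c) m → IsFloor (+ (ι ^[ k ]) m) (r (+ m))
    floor-on k c r floor-fact = power-floor k r floor-fact ∘ InR⇒InClass c
    fixed-on : ∀ k c → next^ k c ≡ c → InR (R-index c) (R-shift c) m → (ι ^[ k ]) m ≡ m
    fixed-on k c cycle = power-fixed k cycle ∘ InR⇒InClass c

theorem4p4 : Σ (ℕ → ℕ) IotaSpec ×
    ((ι : ℕ → ℕ) → IotaSpec ι → IsPermPos ι × HasOrder6 ι × PowerFormulas ι)
theorem4p4 = (ι₀ , ShapeSpec⇒IotaSpec ι₀-shape) , λ ι spec →
  let open Dynamics ι (IotaSpec⇒ShapeSpec spec) in ι-permutation , ι-order-6 , ι-powers
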